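{- Let $\lambda$ be a partition, $\nu\in\mathcal{U}(\lambda)$, and let $(x,y)$ be the cell $\nu/\lambda$. For integers $u,v\ge0$ let $c=(x+u,y+v)$, $c_1=(x+u,y)$ and $c_2=(x,y+v)$. Then $$P_{(q,t)}(\nu\mid c)=P_{(q,t)}(\nu\mid c_1)\,P_{(q,t)}(\nu\mid c_2).$$
   Context: Partitions are identified with their Young diagrams in French convention: $\lambda$ is the set of cells $(x,y)\in\mathbb{Z}_{>0}^2$ with $x\le\lambda_y$ (with $\lambda_j=0$ beyond its length); $\lambda'$ is the conjugate (with $\lambda'_i=0$ for $i>\lambda_1$). $\mathcal{U}(\lambda)$ is the set of partitions $\nu\supseteq\lambda$ with $\nu/\lambda$ a single cell (an outer corner of $\lambda$). $\overline{\lambda}=\mathbb{Z}_{>0}^2\setminus\lambda$. For $c=(x,y)\in\overline{\lambda}$, ${\rm arm}_\lambda(c)=\{(i,y):\lambda_y<i<x\}$, ${\rm leg}_\lambda(c)=\{(x,j):\lambda'_x<j<y\}$, $a_\lambda(c)=|{\rm arm}_\lambda(c)|$, $\ell_\lambda(c)=|{\rm leg}_\lambda(c)|$; $c$ is an outer corner iff both are empty. For $c'\in{\rm arm}_\lambda(c)\cup{\rm leg}_\lambda(c)$ set $$P(c\to c')=\begin{cases}q^{a(c)-i}\dfrac{t^{\ell(c)}(1-q)}{1-q^{a(c)}t^{\ell(c)}}&c'=(x-i,y)\in{\rm arm}_\lambda(c),\\[2mm] t^{j-1}\dfrac{1-t}{1-q^{a(c)}t^{\ell(c)}}&c'=(x,y-j)\in{\rm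 leg}_\lambda(c),\end{cases}$$ with $a=a_\lambda$, $\ell=\ell_\lambda$. The exterior $(q,t)$-hook walk from $c$ stops if $c$ is an outer corner, and otherwise moves to $c'$ with probability $P(c\to c')$ and repeats. $P_{(q,t)}(\nu\mid c)$ is the probability it terminates at $\nu/\lambda$: the sum over all sequences $c=c_0,\dots,c_m=\nu/\lambda$ with $c_{k+1}\in{\rm arm}_\lambda(c_k)\cup{\rm leg}_\lambda(c_k)$ and $c_0,\dots,c_{m-1}$ not outer corners, of $\prod_k P(c_k\to c_{k+1})$ (so $P_{(q,t)}(\nu\mid\nu/\lambda)=1$). -}

module Defs where

open import Data.Nat as ℕ using (ℕ; zero; suc; _∸_; _<ᵇ_; _≤ᵇ_)
open import Data.Bool using (Bool; true; false; if_then_else_; _∧_; not)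
open import Data.List using (List; []; _∷_; length; filter; foldr; map; upTo; lookup)
open import Data.List.Relation.Unary.Linked using (Linked)
open import Data.List.Relation.Unary.All using (All)
open import Data.Product using (_×_; _,_; proj₁; proj₂)
open import Data.Rational using (ℚ; 0ℚ; 1ℚ; _+_; _*_; _-_; 1/_; ≢-nonZero)
open import Data.Rational.Properties using (_≟_)
open import Relation.Nullary using (yes; no)
open import Relation.Unary using (Pred)

record Partition : Set where
  constructor mkPartition
  field
    parts      : List ℕ
    decreasing : Linked ℕ._≥_ parts
    positive   : All (ℕ._<_ 0) parts
open Partition public

-- λ_y for y ≥ 1 (and 0 beyond the length; row index 0 is unused)
row : Partition → ℕ → ℕ
row λp y = go (parts λp) y
  where
  go : List ℕ → ℕ → ℕ
  go []       _             = 0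
  go (p ∷ ps) zero          = 0
  go (p ∷ ps) (suc zero)    = p
  go (p ∷ ps) (suc (suc k)) = go ps (suc k)

col : Partition → ℕ → ℕ
col λp x = length (filter (λ p → x ℕ.≤? p) (parts λp))

-- Cells are pairs (x , y) of naturals, meant with x , y ≥ 1 (French convention:
-- x = column, y = row).  (x , y) ∈ λ  iff  1 ≤ x ≤ λ_y.
Cell : Set
Cell = ℕ × ℕ

-- (x , y) ∈ λ̄ (complement)  iff  x > λ_y   (for x , y ≥ 1)
-- a_λ(c) = |{ i : λ_y < i < x }| and ℓ_λ(c) = |{ j : λ'_x < j < y }|
armLen : Partition → Cell → ℕ
armLen λp (x , y) = x ∸ suc (row λp y)

legLen : Partition → Cell → ℕ
legLen λp (x , y) = y ∸ suc (col λp x)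

IsOuterCorner : Partition → Cell → Set
IsOuterCorner λp (x , y) =
  (1 ℕ.≤ x) × (1 ℕ.≤ y) × (row λp y ℕ.< x) × (armLen λp (x , y) ≡' 0) × (legLen λp (x , y) ≡' 0)
  where
  open import Relation.Binary.PropositionalEquality using () renaming (_≡_ to _≡'_)

infixr 8 _^_
_^_ : ℚ → ℕ → ℚ
p ^ zero  = 1ℚ
p ^ suc n = p * (p ^ n)

-- total division; only ever used with non-zero denominators under the
-- hypothesis of the theorem (returns 0 on a zero denominator)
_/'_ : ℚ → ℚ → ℚ
p /' d with d ≟ 0ℚ
... | yes _  = 0ℚ
... | no d≢0 = p * (1/ d) {{≢-nonZero d≢0}}

sumℚ : List ℚ → ℚ
sumℚ = foldr _+_ 0ℚ

oneTo : ℕ → List ℕ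
oneTo n = map suc (upTo n)

-- Exterior (q,t)-hook walk.
-- walkProb q t λ fuel c d = probability that the walk started at c
-- terminates at the outer corner d (sum over paths of products of the
-- transition probabilities).  Each step strictly decreases x + y, so
-- fuel = x + y suffices.

isCornerᵇ : Partition → Cell → Bool
isCornerᵇ λp c with armLen λp c | legLen λp c
... | zero | zero = true
... | _    | _    = false

cellEqᵇ : Cell → Cell → Bool
cellEqᵇ (x , y) (x' , y') = (x ℕ.≡ᵇ x') ∧ (y ℕ.≡ᵇ y')

walkProb : ℚ → ℚ → Partition → ℕ → Cell → Cell → ℚ
walkProb q t λp zero      c d = 0ℚ
walkProb q t λp (suc fuel) (x , y) d =
  if isCornerᵇ λp (x , y)
  then (if cellEqᵇ (x , y) d then 1ℚ else 0ℚ)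
  else (sumℚ (map armStep (oneTo a)) + sumℚ (map legStep (oneTo l)))
  where
  a = armLen λp (x , y)
  l = legLen λp (x , y)
  den = 1ℚ - (q ^ a) * (t ^ l)
  armStep : ℕ → ℚ
  armStep i = (((q ^ (a ∸ i)) * (t ^ l) * (1ℚ - q)) /' den)
              * walkProb q t λp fuel (x ∸ i , y) d
  legStep : ℕ → ℚ
  legStep j = (((t ^ (j ∸ 1)) * (1ℚ - t)) /' den)
              * walkProb q t λp fuel (x , y ∸ j) d

-- P_{(q,t)}(ν | c) where ν/λ = d
P : ℚ → ℚ → Partition → Cell → Cell → ℚ
P q t λp (x , y) d = walkProb q t λp (suc (x ℕ.+ y)) (x , y) d

-- Put F i j = P(ν | (x + i , y + j)).  As λ_{y+j} ≤ λ_y < x and λ'_{x+i} ≤ λ'_x < y, the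
-- cell (x + i , y + j) has arm i + A j and leg j + L i, where A j is the arm of (x , y + j)
-- and L i the leg of (x + i , y).  A move ending left of column x or below row y can never
-- reach (x , y), so clearing the denominator of the first step of the walk gives
--   (1 - σ i τ j) F i j = τ j Σₖ hᵢₖ F (i-k) j + Σₘ gₘ F i (j-m),
-- with σ i = q^i t^(L i), τ j = q^(A j) t^j: the arm weights are τ j times those of row y,
-- and the leg weights do not depend on i.  Specialising to j = 0 and to i = 0 shows that
-- F i 0 · F 0 j satisfies the same recurrence, and the denominators 1 - σ i τ j never
-- vanish, so F i j = F i 0 · F 0 j by induction on i + j.
module Submission where

open import Defs
open import Data.Nat using (ℕ; _+_; _<_)
open import Data.Product using (_,_)
open import Data.Rational using (ℚ; 1ℚ) renaming (_*_ to _*ℚ_)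
open import Relation.Binary.PropositionalEquality using (_≡_; _≢_)

open import Data.Bool using (true; false; if_then_else_; _∧_)
open import Data.Bool.Properties using (∧-zeroʳ; if-cong; if-cong-else; if-cong₂; if-eta)
open import Data.Empty using (⊥-elim)
open import Data.List using ([]; _∷_; map; filter; length)
open import Data.List.Properties using (map-∘; map-applyUpTo; filter-none)
import Data.List.Relation.Unary.All as All
import Data.List.Relation.Unary.Linked as Linked
open import Data.List.Relation.Unary.Linked using (_∷_)
open import Data.List.Relation.Unary.Linked.Properties using (Linked⇒All)
open import Data.List.Relation.Binary.Sublist.Propositional using (⊆-refl)
open import Data.List.Relation.Binary.Sublist.Propositional.Properties using (filter⁺; length-mono-≤)
open import Data.Nat as ℕ using (zero; suc; _∸_; _≤_; _≤?_; _≤ᵇ_; _≡ᵇ_; z≤n; s≤s)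
import Data.Nat.Properties as ℕₚ
open import Data.Product using (proj₁; proj₂)
open import Data.Rational using (0ℚ; _-_; 1/_; ≢-nonZero) renaming (_+_ to _+ℚ_)
import Data.Rational.Properties as ℚₚ
open import Data.Rational.Solver using (module +-*-Solver)
open +-*-Solver using (solve; _:=_; _:+_; _:-_; _:*_; con)
open import Data.Sum as Sum using (_⊎_; inj₁; inj₂)
open import Function using (_∘_; id)
open import Relation.Binary.PropositionalEquality using (refl; sym; trans; cong; cong₂; subst; module ≡-Reasoning)
open import Relation.Nullary using (yes; no)
open import Relation.Nullary.Decidable using (dec-true; dec-false)

∑ : ℕ → (ℕ → ℚ) → ℚ
∑ zero    f = 0ℚ
∑ (suc n) f = f 1 +ℚ ∑ n (f ∘ suc)

oneTo-suc : ∀ n → oneTo (suc n) ≡ 1 ∷ map suc (oneTo n)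
oneTo-suc n = cong (λ ks → 1 ∷ map suc ks) (sym (map-applyUpTo id suc n))

sumℚ-map-oneTo : ∀ f n → sumℚ (map f (oneTo n)) ≡ ∑ n f
sumℚ-map-oneTo f zero    = refl
sumℚ-map-oneTo f (suc n) = begin
  sumℚ (map f (oneTo (suc n)))           ≡⟨ cong (sumℚ ∘ map f) (oneTo-suc n) ⟩
  f 1 +ℚ sumℚ (map f (map suc (oneTo n))) ≡⟨ cong (λ xs → f 1 +ℚ sumℚ xs) (sym (map-∘ (oneTo n))) ⟩
  f 1 +ℚ sumℚ (map (f ∘ suc) (oneTo n))   ≡⟨ cong (f 1 +ℚ_) (sumℚ-map-oneTo (f ∘ suc) n) ⟩
  ∑ (suc n) f                             ∎
  where open ≡-Reasoning

∑-cong : ∀ n {f g : ℕ → ℚ} → (∀ k → 1 ≤ k → k ≤ n → f k ≡ g k) → ∑ n f ≡ ∑ n g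
∑-cong zero    f≗g = refl
∑-cong (suc n) f≗g =
  cong₂ _+ℚ_ (f≗g 1 ℕₚ.≤-refl (s≤s z≤n)) (∑-cong n (λ k _ k≤n → f≗g (suc k) (s≤s z≤n) (s≤s k≤n)))

∑-zero : ∀ n {f : ℕ → ℚ} → (∀ k → 1 ≤ k → k ≤ n → f k ≡ 0ℚ) → ∑ n f ≡ 0ℚ
∑-zero zero    f≗0 = refl
∑-zero (suc n) f≗0 =
  cong₂ _+ℚ_ (f≗0 1 ℕₚ.≤-refl (s≤s z≤n)) (∑-zero n (λ k _ k≤n → f≗0 (suc k) (s≤s z≤n) (s≤s k≤n)))

∑-truncate : ∀ m n {f : ℕ → ℚ} → (∀ k → 1 ≤ k → k ≤ n → f (m + k) ≡ 0ℚ) → ∑ (m + n) f ≡ ∑ m f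
∑-truncate zero    n     tail≗0 = ∑-zero n tail≗0
∑-truncate (suc m) n {f} tail≗0 = cong (f 1 +ℚ_) (∑-truncate m n tail≗0)

*-distribˡ-∑ : ∀ c n (f : ℕ → ℚ) → c *ℚ ∑ n f ≡ ∑ n (λ k → c *ℚ f k)
*-distribˡ-∑ c zero    f = ℚₚ.*-zeroʳ c
*-distribˡ-∑ c (suc n) f = trans (ℚₚ.*-distribˡ-+ c (f 1) _) (cong (c *ℚ f 1 +ℚ_) (*-distribˡ-∑ c n (f ∘ suc)))

^-distribˡ-+-* : ∀ p m n → p ^ (m + n) ≡ p ^ m *ℚ p ^ n
^-distribˡ-+-* p zero    n = sym (ℚₚ.*-identityˡ (p ^ n))
^-distribˡ-+-* p (suc m) n = trans (cong (p *ℚ_) (^-distribˡ-+-* p m n)) (sym (ℚₚ.*-assoc p _ _))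

1-p≢0 : ∀ {p} → p ≢ 1ℚ → 1ℚ - p ≢ 0ℚ
1-p≢0 {p} p≢1 1-p≡0 = p≢1 (begin
  p              ≡⟨ solve 1 (λ p → p := con 1ℚ :- (con 1ℚ :- p)) refl p ⟩
  1ℚ - (1ℚ - p)  ≡⟨ cong (1ℚ -_) 1-p≡0 ⟩
  1ℚ             ∎)
  where open ≡-Reasoning

d*[c/'d*w]≡c*w : ∀ c d w → d ≢ 0ℚ → d *ℚ ((c /' d) *ℚ w) ≡ c *ℚ w
d*[c/'d*w]≡c*w c d w d≢0 with d ℚₚ.≟ 0ℚ
... | yes d≡0 = ⊥-elim (d≢0 d≡0)
... | no  _   = begin
  d *ℚ (c *ℚ 1/ d *ℚ w)  ≡⟨ solve 4 (λ c d d⁻¹ w → d :* (c :* d⁻¹ :* w) := c :* w :* (d :* d⁻¹)) refl c d (1/ d) w ⟩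
  c *ℚ w *ℚ (d *ℚ 1/ d)  ≡⟨ cong (c *ℚ w *ℚ_) (ℚₚ.*-inverseʳ d) ⟩
  c *ℚ w *ℚ 1ℚ           ≡⟨ ℚₚ.*-identityʳ (c *ℚ w) ⟩
  c *ℚ w                 ∎
  where
  open ≡-Reasoning
  instance _ = ≢-nonZero d≢0

*-cancelˡ-≢0 : ∀ d {p r} → d ≢ 0ℚ → d *ℚ p ≡ d *ℚ r → p ≡ r
*-cancelˡ-≢0 d {p} {r} d≢0 dp≡dr = begin
  p                  ≡⟨ undo p ⟩
  1/ d *ℚ (d *ℚ p)   ≡⟨ cong (1/ d *ℚ_) dp≡dr ⟩
  1/ d *ℚ (d *ℚ r)   ≡⟨ sym (undo r) ⟩
  r                  ∎
  where
  open ≡-Reasoning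
  instance _ = ≢-nonZero d≢0
  undo : ∀ s → s ≡ 1/ d *ℚ (d *ℚ s)
  undo s = sym (begin
    1/ d *ℚ (d *ℚ s)  ≡⟨ sym (ℚₚ.*-assoc (1/ d) d s) ⟩
    1/ d *ℚ d *ℚ s    ≡⟨ cong (_*ℚ s) (ℚₚ.*-inverseˡ d) ⟩
    1ℚ *ℚ s           ≡⟨ ℚₚ.*-identityˡ s ⟩
    s                 ∎)

m∸n<m : ∀ m n → 1 ≤ m → 1 ≤ n → m ∸ n < m
m∸n<m (suc m) (suc n) _ _ = s≤s (ℕₚ.m∸n≤m m n)

module SeparableRecurrence
  (σ τ : ℕ → ℚ) (h : ℕ → ℕ → ℚ) (g : ℕ → ℚ) (F : ℕ → ℕ → ℚ)
  (σ0≡1 : σ 0 ≡ 1ℚ) (τ0≡1 : τ 0 ≡ 1ℚ) (F00≡1 : F 0 0 ≡ 1ℚ)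
  (1-στ≢0 : ∀ i j → 0 < i + j → 1ℚ - σ i *ℚ τ j ≢ 0ℚ)
  (recurrence : ∀ i j → 0 < i + j →
    (1ℚ - σ i *ℚ τ j) *ℚ F i j ≡ τ j *ℚ ∑ i (λ k → h i k *ℚ F (i ∸ k) j) +ℚ ∑ j (λ m → g m *ℚ F i (j ∸ m)))
  where

  row-recurrence : ∀ i → 0 < i → ∑ i (λ k → h i k *ℚ F (i ∸ k) 0) ≡ (1ℚ - σ i) *ℚ F i 0
  row-recurrence i 0<i = sym (begin
    (1ℚ - σ i) *ℚ F i 0
      ≡⟨ cong (λ s → (1ℚ - s) *ℚ F i 0) (sym (trans (cong (σ i *ℚ_) τ0≡1) (ℚₚ.*-identityʳ (σ i)))) ⟩
    (1ℚ - σ i *ℚ τ 0) *ℚ F i 0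
      ≡⟨ recurrence i 0 (ℕₚ.<-≤-trans 0<i (ℕₚ.m≤m+n i 0)) ⟩
    τ 0 *ℚ ∑ i (λ k → h i k *ℚ F (i ∸ k) 0) +ℚ 0ℚ
      ≡⟨ cong (λ c → c *ℚ _ +ℚ 0ℚ) τ0≡1 ⟩
    1ℚ *ℚ ∑ i (λ k → h i k *ℚ F (i ∸ k) 0) +ℚ 0ℚ
      ≡⟨ solve 1 (λ S → con 1ℚ :* S :+ con 0ℚ := S) refl _ ⟩
    ∑ i (λ k → h i k *ℚ F (i ∸ k) 0) ∎)
    where open ≡-Reasoning

  column-recurrence : ∀ j → 0 < j → ∑ j (λ m → g m *ℚ F 0 (j ∸ m)) ≡ (1ℚ - τ j) *ℚ F 0 j
  column-recurrence j 0<j = sym (begin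
    (1ℚ - τ j) *ℚ F 0 j
      ≡⟨ cong (λ s → (1ℚ - s) *ℚ F 0 j) (sym (trans (cong (_*ℚ τ j) σ0≡1) (ℚₚ.*-identityˡ (τ j)))) ⟩
    (1ℚ - σ 0 *ℚ τ j) *ℚ F 0 j
      ≡⟨ recurrence 0 j 0<j ⟩
    τ j *ℚ 0ℚ +ℚ ∑ j (λ m → g m *ℚ F 0 (j ∸ m))
      ≡⟨ solve 2 (λ T S → T :* con 0ℚ :+ S := S) refl (τ j) _ ⟩
    ∑ j (λ m → g m *ℚ F 0 (j ∸ m)) ∎)
    where open ≡-Reasoning

  separable-step : ∀ i j → 0 < i → 0 < j →
    (∀ i' j' → i' + j' < i + j → F i' j' ≡ F i' 0 *ℚ F 0 j') → F i j ≡ F i 0 *ℚ F 0 j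
  separable-step i j 0<i 0<j ih = *-cancelˡ-≢0 (1ℚ - σ i *ℚ τ j) (1-στ≢0 i j 0<i+j) (begin
    (1ℚ - σ i *ℚ τ j) *ℚ F i j
      ≡⟨ recurrence i j 0<i+j ⟩
    τ j *ℚ ∑ i (λ k → h i k *ℚ F (i ∸ k) j) +ℚ ∑ j (λ m → g m *ℚ F i (j ∸ m))
      ≡⟨ cong₂ (λ R C → τ j *ℚ R +ℚ C)
           (trans (∑-cong i split-row) (sym (*-distribˡ-∑ (F 0 j) i _)))
           (trans (∑-cong j split-column) (sym (*-distribˡ-∑ (F i 0) j _))) ⟩
    τ j *ℚ (F 0 j *ℚ ∑ i (λ k → h i k *ℚ F (i ∸ k) 0)) +ℚ F i 0 *ℚ ∑ j (λ m → g m *ℚ F 0 (j ∸ m))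
      ≡⟨ cong₂ (λ R C → τ j *ℚ (F 0 j *ℚ R) +ℚ F i 0 *ℚ C) (row-recurrence i 0<i) (column-recurrence j 0<j) ⟩
    τ j *ℚ (F 0 j *ℚ ((1ℚ - σ i) *ℚ F i 0)) +ℚ F i 0 *ℚ ((1ℚ - τ j) *ℚ F 0 j)
      ≡⟨ solve 4 (λ s t R C → t :* (C :* ((con 1ℚ :- s) :* R)) :+ R :* ((con 1ℚ :- t) :* C)
                              := (con 1ℚ :- s :* t) :* (R :* C))
               refl (σ i) (τ j) (F i 0) (F 0 j) ⟩
    (1ℚ - σ i *ℚ τ j) *ℚ (F i 0 *ℚ F 0 j) ∎)
    where
    open ≡-Reasoning
    0<i+j : 0 < i + j
    0<i+j = ℕₚ.<-≤-trans 0<i (ℕₚ.m≤m+n i j)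
    split-row : ∀ k → 1 ≤ k → k ≤ i → h i k *ℚ F (i ∸ k) j ≡ F 0 j *ℚ (h i k *ℚ F (i ∸ k) 0)
    split-row k 1≤k k≤i = begin
      h i k *ℚ F (i ∸ k) j
        ≡⟨ cong (h i k *ℚ_) (ih (i ∸ k) j (ℕₚ.+-monoˡ-< j (m∸n<m i k (ℕₚ.≤-trans 1≤k k≤i) 1≤k))) ⟩
      h i k *ℚ (F (i ∸ k) 0 *ℚ F 0 j)
        ≡⟨ solve 3 (λ H R C → H :* (R :* C) := C :* (H :* R)) refl (h i k) (F (i ∸ k) 0) (F 0 j) ⟩
      F 0 j *ℚ (h i k *ℚ F (i ∸ k) 0) ∎
    split-column : ∀ m → 1 ≤ m → m ≤ j → g m *ℚ F i (j ∸ m) ≡ F i 0 *ℚ (g m *ℚ F 0 (j ∸ m))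
    split-column m 1≤m m≤j = begin
      g m *ℚ F i (j ∸ m)
        ≡⟨ cong (g m *ℚ_) (ih i (j ∸ m) (ℕₚ.+-monoʳ-< i (m∸n<m j m (ℕₚ.≤-trans 1≤m m≤j) 1≤m))) ⟩
      g m *ℚ (F i 0 *ℚ F 0 (j ∸ m))
        ≡⟨ solve 3 (λ G R C → G :* (R :* C) := R :* (G :* C)) refl (g m) (F i 0) (F 0 (j ∸ m)) ⟩
      F i 0 *ℚ (g m *ℚ F 0 (j ∸ m)) ∎

  separable-below : ∀ n i j → i + j < n → F i j ≡ F i 0 *ℚ F 0 j
  separable-below (suc n) zero    j       _ = sym (trans (cong (_*ℚ F 0 j) F00≡1) (ℚₚ.*-identityˡ (F 0 j)))
  separable-below (suc n) (suc i) zero    _ = sym (trans (cong (F (suc i) 0 *ℚ_) F00≡1) (ℚₚ.*-identityʳ (F (suc i) 0)))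
  separable-below (suc n) (suc i) (suc j) (s≤s i+j<n) = separable-step (suc i) (suc j) (s≤s z≤n) (s≤s z≤n)
    (λ i' j' smaller → separable-below n i' j' (ℕₚ.<-≤-trans smaller i+j<n))

  separable : ∀ i j → F i j ≡ F i 0 *ℚ F 0 j
  separable i j = separable-below (suc (i + j)) i j ℕₚ.≤-refl

row-step : ∀ λp {y} → 1 ≤ y → row λp (suc y) ≤ row λp y
row-step (mkPartition []                _       _)   {suc y}       _ = z≤n
row-step (mkPartition (p ∷ [])          _       _)   {suc zero}    _ = z≤n
row-step (mkPartition (p ∷ p' ∷ ps) (p≥p' ∷ _)  _)   {suc zero}    _ = p≥p'
row-step (mkPartition (p ∷ [])          _       _)   {suc (suc y)} _ = z≤n
row-step (mkPartition (p ∷ p' ∷ ps) (_ ∷ ≥ps) (_ All.∷ >ps)) {suc (suc y)} _ =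
  row-step (mkPartition (p' ∷ ps) ≥ps >ps) (s≤s z≤n)

row-antitone : ∀ λp {y} j → 1 ≤ y → row λp (y + j) ≤ row λp y
row-antitone λp {y} zero    1≤y rewrite ℕₚ.+-identityʳ y = ℕₚ.≤-refl
row-antitone λp {y} (suc j) 1≤y rewrite ℕₚ.+-suc y j =
  ℕₚ.≤-trans (row-step λp (ℕₚ.≤-trans 1≤y (ℕₚ.m≤m+n y j))) (row-antitone λp j 1≤y)

col-antitone : ∀ λp {x x'} → x ≤ x' → col λp x' ≤ col λp x
col-antitone λp x≤x' =
  length-mono-≤ (filter⁺ (_ ≤?_) (_ ≤?_) (λ { refl x'≤p → ℕₚ.≤-trans x≤x' x'≤p }) (⊆-refl {x = parts λp}))

length-filter-∷ : ∀ x p ps → length (filter (x ≤?_) (p ∷ ps)) ≤ suc (length (filter (x ≤?_) ps))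
length-filter-∷ x p ps with x ≤ᵇ p
... | true  = ℕₚ.≤-refl
... | false = ℕₚ.n≤1+n _

row<⇒col< : ∀ λp {x y} → 1 ≤ y → row λp y < x → col λp x < y
row<⇒col< (mkPartition []       _   _)   {y = suc y} _ _ = s≤s z≤n
row<⇒col< (mkPartition (p ∷ ps) ≥ps _) {x} {suc zero} _ p<x =
  s≤s (ℕₚ.≤-reflexive (cong length (filter-none (x ≤?_) (All.map (λ r≤p → ℕₚ.<⇒≱ (ℕₚ.≤-<-trans r≤p p<x)) parts≤p))))
  where
  parts≤p : All.All (_≤ p) (p ∷ ps)
  parts≤p = Linked⇒All (λ j≤i k≤j → ℕₚ.≤-trans k≤j j≤i) ℕₚ.≤-refl ≥ps
row<⇒col< (mkPartition (p ∷ ps) ≥ps (_ All.∷ >ps)) {x} {suc (suc y)} _ row<x =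
  ℕₚ.≤-<-trans (length-filter-∷ x p ps) (s≤s (row<⇒col< (mkPartition ps (Linked.tail ≥ps) >ps) (s≤s z≤n) row<x))

cellEqᵇ-outside : ∀ {X Y dx dy} → X < dx ⊎ Y < dy → cellEqᵇ (X , Y) (dx , dy) ≡ false
cellEqᵇ-outside {X} {Y} {dx} {dy} (inj₁ X<dx) = cong (_∧ (Y ≡ᵇ dy)) (dec-false (X ℕ.≟ dx) (ℕₚ.<⇒≢ X<dx))
cellEqᵇ-outside {X} {Y} {dx} {dy} (inj₂ Y<dy) =
  trans (cong ((X ≡ᵇ dx) ∧_) (dec-false (Y ℕ.≟ dy) (ℕₚ.<⇒≢ Y<dy))) (∧-zeroʳ (X ≡ᵇ dx))

cellEqᵇ-refl : ∀ c → cellEqᵇ c c ≡ true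
cellEqᵇ-refl (X , Y) = cong₂ _∧_ (dec-true (X ℕ.≟ X) refl) (dec-true (Y ℕ.≟ Y) refl)

isCornerᵇ-true : ∀ λp c → armLen λp c ≡ 0 → legLen λp c ≡ 0 → isCornerᵇ λp c ≡ true
isCornerᵇ-true λp c a≡0 l≡0 with armLen λp c | legLen λp c
isCornerᵇ-true λp c refl refl | zero | zero = refl

isCornerᵇ-false : ∀ λp c → 0 < armLen λp c + legLen λp c → isCornerᵇ λp c ≡ false
isCornerᵇ-false λp c 0<a+l with armLen λp c | legLen λp c
isCornerᵇ-false λp c () | zero  | zero
... | zero  | suc _ = refl
... | suc _ | _     = refl

module HookWalk (q t : ℚ) (λp : Partition) where

  W : ℕ → Cell → Cell → ℚ
  W = walkProb q t λp

  den : ℕ → ℕ → ℚ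
  den a l = 1ℚ - q ^ a *ℚ t ^ l

  armWeight : ℕ → ℕ → ℕ → ℚ
  armWeight a l k = q ^ (a ∸ k) *ℚ t ^ l *ℚ (1ℚ - q)

  legWeight : ℕ → ℚ
  legWeight k = t ^ (k ∸ 1) *ℚ (1ℚ - t)

  moves : ℕ → Cell → Cell → ℚ
  moves n (X , Y) d =
    ∑ a (λ k → (armWeight a l k /' den a l) *ℚ W n (X ∸ k , Y) d)
    +ℚ ∑ l (λ k → (legWeight k /' den a l) *ℚ W n (X , Y ∸ k) d)
    where
    a = armLen λp (X , Y)
    l = legLen λp (X , Y)

  armWeight-+ : ∀ {i k} a j l → k ≤ i → armWeight (i + a) (j + l) k ≡ (q ^ a *ℚ t ^ j) *ℚ armWeight i l k
  armWeight-+ {i} {k} a j l k≤i = begin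
    q ^ ((i + a) ∸ k) *ℚ t ^ (j + l) *ℚ (1ℚ - q)
      ≡⟨ cong (λ e → q ^ e *ℚ t ^ (j + l) *ℚ (1ℚ - q)) (ℕₚ.+-∸-comm a k≤i) ⟩
    q ^ ((i ∸ k) + a) *ℚ t ^ (j + l) *ℚ (1ℚ - q)
      ≡⟨ cong₂ (λ Q T → Q *ℚ T *ℚ (1ℚ - q)) (^-distribˡ-+-* q (i ∸ k) a) (^-distribˡ-+-* t j l) ⟩
    q ^ (i ∸ k) *ℚ q ^ a *ℚ (t ^ j *ℚ t ^ l) *ℚ (1ℚ - q)
      ≡⟨ solve 5 (λ Qik Qa Tj Tl q → Qik :* Qa :* (Tj :* Tl) :* (con 1ℚ :- q) := Qa :* Tj :* (Qik :* Tl :* (con 1ℚ :- q)))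
               refl (q ^ (i ∸ k)) (q ^ a) (t ^ j) (t ^ l) q ⟩
    (q ^ a *ℚ t ^ j) *ℚ armWeight i l k ∎
    where open ≡-Reasoning

  arrival : Cell → Cell → ℚ
  arrival c d = if cellEqᵇ c d then 1ℚ else 0ℚ

  walkProb-suc : ∀ n X Y d →
    W (suc n) (X , Y) d ≡ (if isCornerᵇ λp (X , Y) then arrival (X , Y) d else moves n (X , Y) d)
  walkProb-suc n X Y d = if-cong-else (isCornerᵇ λp (X , Y))
    (cong₂ _+ℚ_ (sumℚ-map-oneTo (λ k → (armWeight a l k /' den a l) *ℚ W n (X ∸ k , Y) d) a)
                (sumℚ-map-oneTo (λ k → (legWeight k /' den a l) *ℚ W n (X , Y ∸ k) d) l))
    where
    a = armLen λp (X , Y)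
    l = legLen λp (X , Y)

  arm-decreases : ∀ X Y {k} → 1 ≤ k → k ≤ armLen λp (X , Y) → (X ∸ k) + Y < X + Y
  arm-decreases X Y 1≤k k≤a =
    ℕₚ.+-monoˡ-< Y (m∸n<m X _ (ℕₚ.≤-trans 1≤k (ℕₚ.≤-trans k≤a (ℕₚ.m∸n≤m X (suc (row λp Y))))) 1≤k)

  leg-decreases : ∀ X Y {k} → 1 ≤ k → k ≤ legLen λp (X , Y) → X + (Y ∸ k) < X + Y
  leg-decreases X Y 1≤k k≤l =
    ℕₚ.+-monoʳ-< X (m∸n<m Y _ (ℕₚ.≤-trans 1≤k (ℕₚ.≤-trans k≤l (ℕₚ.m∸n≤m Y (suc (col λp X))))) 1≤k)

  walkProb-fuel : ∀ n m X Y d → X + Y < n → X + Y < m → W n (X , Y) d ≡ W m (X , Y) d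
  walkProb-fuel (suc n) (suc m) X Y d (s≤s X+Y≤n) (s≤s X+Y≤m) = begin
    W (suc n) (X , Y) d
      ≡⟨ walkProb-suc n X Y d ⟩
    (if isCornerᵇ λp (X , Y) then arrival (X , Y) d else moves n (X , Y) d)
      ≡⟨ if-cong-else (isCornerᵇ λp (X , Y)) (cong₂ _+ℚ_ (∑-cong a arm-fuel) (∑-cong l leg-fuel)) ⟩
    (if isCornerᵇ λp (X , Y) then arrival (X , Y) d else moves m (X , Y) d)
      ≡⟨ sym (walkProb-suc m X Y d) ⟩
    W (suc m) (X , Y) d ∎
    where
    open ≡-Reasoning
    a = armLen λp (X , Y)
    l = legLen λp (X , Y)
    arm-fuel : ∀ k → 1 ≤ k → k ≤ a → (armWeight a l k /' den a l) *ℚ W n (X ∸ k , Y) d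
                                   ≡ (armWeight a l k /' den a l) *ℚ W m (X ∸ k , Y) d
    arm-fuel k 1≤k k≤a = cong ((armWeight a l k /' den a l) *ℚ_) (walkProb-fuel n m (X ∸ k) Y d
      (ℕₚ.<-≤-trans smaller X+Y≤n) (ℕₚ.<-≤-trans smaller X+Y≤m))
      where smaller = arm-decreases X Y 1≤k k≤a
    leg-fuel : ∀ k → 1 ≤ k → k ≤ l → (legWeight k /' den a l) *ℚ W n (X , Y ∸ k) d
                                   ≡ (legWeight k /' den a l) *ℚ W m (X , Y ∸ k) d
    leg-fuel k 1≤k k≤l = cong ((legWeight k /' den a l) *ℚ_) (walkProb-fuel n m X (Y ∸ k) d
      (ℕₚ.<-≤-trans smaller X+Y≤n) (ℕₚ.<-≤-trans smaller X+Y≤m))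
      where smaller = leg-decreases X Y 1≤k k≤l

  walkProb-outside : ∀ n X Y dx dy → X < dx ⊎ Y < dy → W n (X , Y) (dx , dy) ≡ 0ℚ
  walkProb-outside zero    X Y dx dy outside = refl
  walkProb-outside (suc n) X Y dx dy outside = begin
    W (suc n) (X , Y) (dx , dy)
      ≡⟨ walkProb-suc n X Y (dx , dy) ⟩
    (if isCornerᵇ λp (X , Y) then arrival (X , Y) (dx , dy) else moves n (X , Y) (dx , dy))
      ≡⟨ if-cong₂ (isCornerᵇ λp (X , Y)) (cong (if_then 1ℚ else 0ℚ) (cellEqᵇ-outside outside)) no-moves ⟩
    (if isCornerᵇ λp (X , Y) then 0ℚ else 0ℚ)
      ≡⟨ if-eta (isCornerᵇ λp (X , Y)) ⟩
    0ℚ ∎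
    where
    open ≡-Reasoning
    a = armLen λp (X , Y)
    l = legLen λp (X , Y)
    no-moves : moves n (X , Y) (dx , dy) ≡ 0ℚ
    no-moves = cong₂ _+ℚ_
      (∑-zero a λ k _ _ → trans (cong ((armWeight a l k /' den a l) *ℚ_)
                                  (walkProb-outside n (X ∸ k) Y dx dy (Sum.map₁ (ℕₚ.≤-<-trans (ℕₚ.m∸n≤m X k)) outside)))
                                (ℚₚ.*-zeroʳ (armWeight a l k /' den a l)))
      (∑-zero l λ k _ _ → trans (cong ((legWeight k /' den a l) *ℚ_)
                                  (walkProb-outside n X (Y ∸ k) dx dy (Sum.map₂ (ℕₚ.≤-<-trans (ℕₚ.m∸n≤m Y k)) outside)))
                                (ℚₚ.*-zeroʳ (legWeight k /' den a l)))

  P-outside : ∀ X Y dx dy → X < dx ⊎ Y < dy → P q t λp (X , Y) (dx , dy) ≡ 0ℚ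
  P-outside X Y = walkProb-outside (suc (X + Y)) X Y

  P-corner : ∀ x y → IsOuterCorner λp (x , y) → P q t λp (x , y) (x , y) ≡ 1ℚ
  P-corner x y (_ , _ , _ , a≡0 , l≡0) = begin
    P q t λp (x , y) (x , y)
      ≡⟨ walkProb-suc (x + y) x y (x , y) ⟩
    (if isCornerᵇ λp (x , y) then arrival (x , y) (x , y) else moves (x + y) (x , y) (x , y))
      ≡⟨ if-cong (isCornerᵇ-true λp (x , y) a≡0 l≡0) ⟩
    arrival (x , y) (x , y)
      ≡⟨ cong (if_then 1ℚ else 0ℚ) (cellEqᵇ-refl (x , y)) ⟩
    1ℚ ∎
    where open ≡-Reasoning

  P-recurrence : ∀ X Y d {a l} → armLen λp (X , Y) ≡ a → legLen λp (X , Y) ≡ l →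
    0 < a + l → den a l ≢ 0ℚ →
    den a l *ℚ P q t λp (X , Y) d
      ≡ ∑ a (λ k → armWeight a l k *ℚ P q t λp (X ∸ k , Y) d)
        +ℚ ∑ l (λ k → legWeight k *ℚ P q t λp (X , Y ∸ k) d)
  P-recurrence X Y d refl refl 0<a+l den≢0 = begin
    den a l *ℚ P q t λp (X , Y) d
      ≡⟨ cong (den a l *ℚ_) (trans (walkProb-suc (X + Y) X Y d) (if-cong (isCornerᵇ-false λp (X , Y) 0<a+l))) ⟩
    den a l *ℚ (∑ a armMove +ℚ ∑ l legMove)
      ≡⟨ ℚₚ.*-distribˡ-+ (den a l) (∑ a armMove) (∑ l legMove) ⟩
    den a l *ℚ ∑ a armMove +ℚ den a l *ℚ ∑ l legMove
      ≡⟨ cong₂ _+ℚ_ (trans (*-distribˡ-∑ (den a l) a armMove) (∑-cong a armStep))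
                    (trans (*-distribˡ-∑ (den a l) l legMove) (∑-cong l legStep)) ⟩
    ∑ a (λ k → armWeight a l k *ℚ P q t λp (X ∸ k , Y) d)
      +ℚ ∑ l (λ k → legWeight k *ℚ P q t λp (X , Y ∸ k) d) ∎
    where
    open ≡-Reasoning
    a = armLen λp (X , Y)
    l = legLen λp (X , Y)
    armMove legMove : ℕ → ℚ
    armMove k = (armWeight a l k /' den a l) *ℚ W (X + Y) (X ∸ k , Y) d
    legMove k = (legWeight k /' den a l) *ℚ W (X + Y) (X , Y ∸ k) d
    armStep : ∀ k → 1 ≤ k → k ≤ a → den a l *ℚ armMove k ≡ armWeight a l k *ℚ P q t λp (X ∸ k , Y) d
    armStep k 1≤k k≤a =
      trans (d*[c/'d*w]≡c*w (armWeight a l k) (den a l) _ den≢0)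
            (cong (armWeight a l k *ℚ_) (walkProb-fuel _ _ (X ∸ k) Y d (arm-decreases X Y 1≤k k≤a) (ℕₚ.n<1+n _)))
    legStep : ∀ k → 1 ≤ k → k ≤ l → den a l *ℚ legMove k ≡ legWeight k *ℚ P q t λp (X , Y ∸ k) d
    legStep k 1≤k k≤l =
      trans (d*[c/'d*w]≡c*w (legWeight k) (den a l) _ den≢0)
            (cong (legWeight k *ℚ_) (walkProb-fuel _ _ X (Y ∸ k) d (leg-decreases X Y 1≤k k≤l) (ℕₚ.n<1+n _)))

module CornerExpansion (q t : ℚ) (q^at^l≢1 : ∀ (a l : ℕ) → 0 < a + l → (q ^ a) *ℚ (t ^ l) ≢ 1ℚ)
  (λp : Partition) {x y : ℕ} (corner : IsOuterCorner λp (x , y)) where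

  open HookWalk q t λp

  F : ℕ → ℕ → ℚ
  F i j = P q t λp (x + i , y + j) (x , y)

  A L : ℕ → ℕ
  A j = armLen λp (x , y + j)
  L i = legLen λp (x + i , y)

  σ τ : ℕ → ℚ
  σ i = q ^ i *ℚ t ^ L i
  τ j = q ^ A j *ℚ t ^ j

  1≤x : 1 ≤ x
  1≤x = proj₁ corner
  1≤y : 1 ≤ y
  1≤y = proj₁ (proj₂ corner)
  row<x : row λp y < x
  row<x = proj₁ (proj₂ (proj₂ corner))
  arm≡0 : armLen λp (x , y) ≡ 0
  arm≡0 = proj₁ (proj₂ (proj₂ (proj₂ corner)))
  leg≡0 : legLen λp (x , y) ≡ 0
  leg≡0 = proj₂ (proj₂ (proj₂ (proj₂ corner)))

  armLen-+ : ∀ i j → armLen λp (x + i , y + j) ≡ i + A j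
  armLen-+ i j = trans (cong (_∸ suc (row λp (y + j))) (ℕₚ.+-comm x i)) (ℕₚ.+-∸-assoc i above-row)
    where
    above-row : row λp (y + j) < x
    above-row = ℕₚ.≤-<-trans (row-antitone λp j 1≤y) row<x

  legLen-+ : ∀ i j → legLen λp (x + i , y + j) ≡ j + L i
  legLen-+ i j = trans (cong (_∸ suc (col λp (x + i))) (ℕₚ.+-comm y j)) (ℕₚ.+-∸-assoc j beside-col)
    where
    beside-col : col λp (x + i) < y
    beside-col = ℕₚ.≤-<-trans (col-antitone λp (ℕₚ.m≤m+n x i)) (row<⇒col< λp 1≤y row<x)

  A0≡0 : A 0 ≡ 0
  A0≡0 = trans (cong (λ Y → armLen λp (x , Y)) (ℕₚ.+-identityʳ y)) arm≡0

  L0≡0 : L 0 ≡ 0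
  L0≡0 = trans (cong (λ X → legLen λp (X , y)) (ℕₚ.+-identityʳ x)) leg≡0

  σ0≡1 : σ 0 ≡ 1ℚ
  σ0≡1 = trans (cong (λ l → 1ℚ *ℚ t ^ l) L0≡0) (ℚₚ.*-identityˡ 1ℚ)

  τ0≡1 : τ 0 ≡ 1ℚ
  τ0≡1 = trans (cong (λ a → q ^ a *ℚ 1ℚ) A0≡0) (ℚₚ.*-identityʳ 1ℚ)

  F00≡1 : F 0 0 ≡ 1ℚ
  F00≡1 = trans (cong₂ (λ X Y → P q t λp (X , Y) (x , y)) (ℕₚ.+-identityʳ x) (ℕₚ.+-identityʳ y)) (P-corner x y corner)

  στ≡ : ∀ i j → σ i *ℚ τ j ≡ q ^ (i + A j) *ℚ t ^ (j + L i)
  στ≡ i j = begin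
    q ^ i *ℚ t ^ L i *ℚ (q ^ A j *ℚ t ^ j)
      ≡⟨ solve 4 (λ Qi Tl Qa Tj → Qi :* Tl :* (Qa :* Tj) := Qi :* Qa :* (Tj :* Tl)) refl (q ^ i) (t ^ L i) (q ^ A j) (t ^ j) ⟩
    q ^ i *ℚ q ^ A j *ℚ (t ^ j *ℚ t ^ L i)
      ≡⟨ sym (cong₂ _*ℚ_ (^-distribˡ-+-* q i (A j)) (^-distribˡ-+-* t j (L i))) ⟩
    q ^ (i + A j) *ℚ t ^ (j + L i) ∎
    where open ≡-Reasoning

  hook-positive : ∀ i j → 0 < i + j → 0 < (i + A j) + (j + L i)
  hook-positive i j 0<i+j = ℕₚ.<-≤-trans 0<i+j (ℕₚ.+-mono-≤ (ℕₚ.m≤m+n i (A j)) (ℕₚ.m≤m+n j (L i)))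

  den≢0 : ∀ i j → 0 < i + j → den (i + A j) (j + L i) ≢ 0ℚ
  den≢0 i j 0<i+j = 1-p≢0 (q^at^l≢1 (i + A j) (j + L i) (hook-positive i j 0<i+j))

  1-στ≢0 : ∀ i j → 0 < i + j → 1ℚ - σ i *ℚ τ j ≢ 0ℚ
  1-στ≢0 i j 0<i+j = subst (λ s → 1ℚ - s ≢ 0ℚ) (sym (στ≡ i j)) (den≢0 i j 0<i+j)

  F-recurrence : ∀ i j → 0 < i + j →
    (1ℚ - σ i *ℚ τ j) *ℚ F i j
      ≡ τ j *ℚ ∑ i (λ k → armWeight i (L i) k *ℚ F (i ∸ k) j) +ℚ ∑ j (λ m → legWeight m *ℚ F i (j ∸ m))
  F-recurrence i j 0<i+j = begin
    (1ℚ - σ i *ℚ τ j) *ℚ F i j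
      ≡⟨ cong (λ s → (1ℚ - s) *ℚ F i j) (στ≡ i j) ⟩
    den a l *ℚ F i j
      ≡⟨ P-recurrence (x + i) (y + j) (x , y) (armLen-+ i j) (legLen-+ i j) (hook-positive i j 0<i+j)
           (den≢0 i j 0<i+j) ⟩
    ∑ a (λ k → armWeight a l k *ℚ P q t λp (x + i ∸ k , y + j) (x , y))
      +ℚ ∑ l (λ m → legWeight m *ℚ P q t λp (x + i , y + j ∸ m) (x , y))
      ≡⟨ cong₂ _+ℚ_ arm-moves leg-moves ⟩
    τ j *ℚ ∑ i (λ k → armWeight i (L i) k *ℚ F (i ∸ k) j) +ℚ ∑ j (λ m → legWeight m *ℚ F i (j ∸ m)) ∎
    where
    open ≡-Reasoning
    a = i + A j
    l = j + L i
    arm-moves : ∑ a (λ k → armWeight a l k *ℚ P q t λp (x + i ∸ k , y + j) (x , y))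
                  ≡ τ j *ℚ ∑ i (λ k → armWeight i (L i) k *ℚ F (i ∸ k) j)
    arm-moves = begin
      ∑ a (λ k → armWeight a l k *ℚ P q t λp (x + i ∸ k , y + j) (x , y))
        ≡⟨ ∑-truncate i (A j) (λ k 1≤k _ → trans (cong (armWeight a l (i + k) *ℚ_) (P-outside (x + i ∸ (i + k)) (y + j) x y (inj₁ (left-of-x k 1≤k))))
                                                  (ℚₚ.*-zeroʳ (armWeight a l (i + k)))) ⟩
      ∑ i (λ k → armWeight a l k *ℚ P q t λp (x + i ∸ k , y + j) (x , y))
        ≡⟨ ∑-cong i (λ k _ k≤i → trans
             (cong₂ _*ℚ_ (armWeight-+ (A j) j (L i) k≤i) (cong (λ X → P q t λp (X , y + j) (x , y)) (ℕₚ.+-∸-assoc x k≤i)))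
             (ℚₚ.*-assoc (τ j) (armWeight i (L i) k) (F (i ∸ k) j))) ⟩
      ∑ i (λ k → τ j *ℚ (armWeight i (L i) k *ℚ F (i ∸ k) j))
        ≡⟨ sym (*-distribˡ-∑ (τ j) i _) ⟩
      τ j *ℚ ∑ i (λ k → armWeight i (L i) k *ℚ F (i ∸ k) j) ∎
      where
      left-of-x : ∀ k → 1 ≤ k → x + i ∸ (i + k) < x
      left-of-x k 1≤k = subst (_< x) (sym (trans (cong (_∸ (i + k)) (ℕₚ.+-comm x i)) (ℕₚ.[m+n]∸[m+o]≡n∸o i x k)))
                              (m∸n<m x k 1≤x 1≤k)
    leg-moves : ∑ l (λ m → legWeight m *ℚ P q t λp (x + i , y + j ∸ m) (x , y))
                  ≡ ∑ j (λ m → legWeight m *ℚ F i (j ∸ m))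
    leg-moves = begin
      ∑ l (λ m → legWeight m *ℚ P q t λp (x + i , y + j ∸ m) (x , y))
        ≡⟨ ∑-truncate j (L i) (λ m 1≤m _ → trans (cong (legWeight (j + m) *ℚ_) (P-outside (x + i) (y + j ∸ (j + m)) x y (inj₂ (below-y m 1≤m))))
                                                  (ℚₚ.*-zeroʳ (legWeight (j + m)))) ⟩
      ∑ j (λ m → legWeight m *ℚ P q t λp (x + i , y + j ∸ m) (x , y))
        ≡⟨ ∑-cong j (λ m _ m≤j → cong (λ Y → legWeight m *ℚ P q t λp (x + i , Y) (x , y)) (ℕₚ.+-∸-assoc y m≤j)) ⟩
      ∑ j (λ m → legWeight m *ℚ F i (j ∸ m)) ∎
      where
      below-y : ∀ m → 1 ≤ m → y + j ∸ (j + m) < y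
      below-y m 1≤m = subst (_< y) (sym (trans (cong (_∸ (j + m)) (ℕₚ.+-comm y j)) (ℕₚ.[m+n]∸[m+o]≡n∸o j y m)))
                            (m∸n<m y m 1≤y 1≤m)

  open SeparableRecurrence σ τ (λ i → armWeight i (L i)) legWeight F σ0≡1 τ0≡1 F00≡1 1-στ≢0 F-recurrence public

lemma6p6 : (q t : ℚ)
    → (∀ (a l : ℕ) → 0 < a + l → (q ^ a) *ℚ (t ^ l) ≢ 1ℚ)
    → (λp : Partition) (x y : ℕ) → IsOuterCorner λp (x , y)
    → (u v : ℕ)
    → P q t λp (x + u , y + v) (x , y)
      ≡ P q t λp (x + u , y) (x , y) *ℚ P q t λp (x , y + v) (x , y)
lemma6p6 q t q^at^l≢1 λp x y corner u v = begin
  F u v          ≡⟨ separable u v ⟩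
  F u 0 *ℚ F 0 v ≡⟨ cong₂ _*ℚ_ (cong (λ Y → P q t λp (x + u , Y) (x , y)) (ℕₚ.+-identityʳ y))
                              (cong (λ X → P q t λp (X , y + v) (x , y)) (ℕₚ.+-identityʳ x)) ⟩
  P q t λp (x + u , y) (x , y) *ℚ P q t λp (x , y + v) (x , y) ∎
  where
  open ≡-Reasoning
  open CornerExpansion q t q^at^l≢1 λp corner
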